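{- Let $M$ be a matroid on $A$ and $N$ a matroid on $B$ that are matched, i.e. $M.(A\cap B)=N|(A\cap B)$. Then the free splice $M\mathbin{\Join} N$ is a splice of $M$ and $N$, and it is the maximum element of the set of all splices of $M$ and $N$ in the weak order; that is, every splice $L$ of $M$ and $N$ satisfies $L\leq M\mathbin{\Join} N$.
   Context: For a matroid $M$ on $E$ and $X\subseteq E$, $M|X$ is the restriction to $X$ and $M.X$ denotes the contraction of $M$ to $X$, i.e. $M/(E-X)$; $r_M$ is the rank function. Matroids $M(A)$ and $N(B)$ are matched if $M.(A\cap B)=N|(A\cap B)$. A splice of matched $M(A)$, $N(B)$ is a matroid $L$ on $A\cup B$ with $L|A=M$ and $L.B=N$. The free splice $M\mathbin{\Join} N$ is the matroid on $A\cup B$ with rank function $r(X)=\min\{r_M(X\cap A)+|X-A|,\ r_N(X\cap B)+r_M(A-B)\}$ for $X\subseteq A\cup B$. The weak order on matroids on a common ground set: $L\leq P$ iff every independent set of $L$ is independent in $P$ (equivalently $r_L\le r_P$ pointwise). -}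

module Defs where

open import Data.Nat using (ℕ; _+_; _∸_; _≤_; _⊓_)
open import Data.Fin.Subset using (Subset; _⊆_; _∩_; _∪_; _─_; ∣_∣)
open import Data.Product using (_×_; Σ)
open import Relation.Binary.PropositionalEquality using (_≡_)

-- Convention: the rank of an arbitrary X is the rank of X ∩ E, so the
-- rank function is determined by its values on subsets of E.
record Matroid (n : ℕ) (E : Subset n) : Set where
  field
    rank       : Subset n → ℕ
    local      : ∀ X → rank X ≡ rank (X ∩ E)
    bounded    : ∀ X → X ⊆ E → rank X ≤ ∣ X ∣
    monotone   : ∀ X Y → X ⊆ Y → Y ⊆ E → rank X ≤ rank Y
    submodular : ∀ X Y → X ⊆ E → Y ⊆ E →
                 rank (X ∪ Y) + rank (X ∩ Y) ≤ rank X + rank Y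
open Matroid public

module _ {n : ℕ} {E : Subset n} where

  restrictRank : Matroid n E → Subset n → Subset n → ℕ
  restrictRank M X Y = rank M (Y ∩ X)

  -- rank function of the contraction M.X = M/(E - X) (a matroid on X)
  contractRank : Matroid n E → Subset n → Subset n → ℕ
  contractRank M X Y = rank M ((Y ∩ X) ∪ (E ─ X)) ∸ rank M (E ─ X)

  Independent : Matroid n E → Subset n → Set
  Independent M I = I ⊆ E × rank M I ≡ ∣ I ∣

  _≤w_ : Matroid n E → Matroid n E → Set
  L ≤w P = ∀ I → Independent L I → Independent P I

module _ {n : ℕ} {A B : Subset n} where

  Matched : Matroid n A → Matroid n B → Set
  Matched M N = ∀ Y → contractRank M (A ∩ B) Y ≡ restrictRank N (A ∩ B) Y

  IsSplice : Matroid n A → Matroid n B → Matroid n (A ∪ B) → Set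
  IsSplice M N L =
    (∀ Y → restrictRank L A Y ≡ rank M Y) ×
    (∀ Y → contractRank L B Y ≡ rank N Y)

  freeSpliceRank : Matroid n A → Matroid n B → Subset n → ℕ
  freeSpliceRank M N X' =
    (rank M (X ∩ A) + ∣ X ─ A ∣) ⊓ (rank N (X ∩ B) + rank M (A ─ B))
    where X = X' ∩ (A ∪ B)

-- The free splice rank is the minimum of f Z = r_M (Z ∩ A) + |Z − A| and g Z = r_N (Z ∩ B) + r_M (A − B).
-- Both terms are submodular, and the matching condition, read as
-- r_N (Y ∩ A ∩ B) + r_M (A − B) = r_M ((Y ∩ A ∩ B) ∪ (A − B)), gives the mixed inequality
-- f (Z ∩ W) + g (Z ∪ W) ≤ f Z + g W; hence the minimum is again submodular and a matroid rank function.
-- On subsets of A the f-term is the smaller one and on sets containing A − B the g-term is, which makes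
-- the free splice a splice. Conversely every splice L satisfies r_L ≤ f (cover Z by Z ∩ A and Z − A)
-- and r_L ≤ g (because L.B = N and L|A = M), so r_L is bounded by the free splice rank, and a rank
-- bound transfers independent sets.
module Submission where

open import Data.Bool using (Bool; true; false; _∧_; _∨_)
import Data.Bool.Properties as Bool
open import Data.Fin using (Fin; #_)
open import Data.Fin.Subset using (Subset; _⊆_; _∩_; _∪_; _─_; ∣_∣; ⊥; _∈_)
open import Data.Fin.Subset.Properties
  using (p∩q⊆p; p∩q⊆q; x∈p∩q⁺; x∈p∩q⁻; q⊆p∪q; p⊆q⇒∣p∣≤∣q∣; ∣p∩q∣≤∣p∣; ∣⊥∣≡0;
         ⊆-antisym; ∩-assoc; ∩-comm; ∩-idem; ∪-comm; ∩-distribʳ-∪)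
open import Data.Nat using (ℕ; zero; suc; _+_; _∸_; _≤_; _⊓_)
open import Data.Nat.Properties
  using (≤-refl; ≤-reflexive; ≤-trans; ≤-antisym; +-mono-≤; +-monoˡ-≤; +-monoʳ-≤; +-cancelʳ-≤;
         +-suc; +-identityʳ; m≤m+n; m∸n+n≡m; m+n∸n≡m; ⊓-sel; ⊓-glb; ⊓-mono-≤; m⊓n≤m; m⊓n≤n;
         m≤n⇒m⊓n≡m; m≥n⇒m⊓n≡n; +-comm; +-commutativeSemigroup; module ≤-Reasoning)
open import Algebra.Properties.CommutativeSemigroup +-commutativeSemigroup using (interchange)
open import Data.Nat.Tactic.RingSolver using (solve-∀)
open import Data.Product using (_×_; Σ; _,_; proj₁; proj₂)
open import Data.Sum using (_⊎_; inj₁; inj₂)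
open import Data.Vec using (Vec; []; _∷_; lookup; map; head; tail)
open import Data.Vec.Properties using (lookup-map)
open import Relation.Nullary.Decidable using (Dec; True; toWitness; map′; _×-dec_)
open import Relation.Binary.PropositionalEquality
  using (_≡_; refl; sym; trans; cong; cong₂; subst; subst₂; module ≡-Reasoning)

open import Defs

module SubsetExpr where

  infixr 7 _∩ₑ_
  infixr 6 _∪ₑ_
  infixl 5 _─ₑ_

  data Expr (k : ℕ) : Set where
    var            : Fin k → Expr k
    ∅ₑ             : Expr k
    _∩ₑ_ _∪ₑ_ _─ₑ_ : Expr k → Expr k → Expr k

  ⟦_⟧ : ∀ {k n} → Expr k → Vec (Subset n) k → Subset n
  ⟦ var i    ⟧ ρ = lookup ρ i
  ⟦ ∅ₑ       ⟧ ρ = ⊥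
  ⟦ e ∩ₑ e′ ⟧ ρ = ⟦ e ⟧ ρ ∩ ⟦ e′ ⟧ ρ
  ⟦ e ∪ₑ e′ ⟧ ρ = ⟦ e ⟧ ρ ∪ ⟦ e′ ⟧ ρ
  ⟦ e ─ₑ e′ ⟧ ρ = ⟦ e ⟧ ρ ─ ⟦ e′ ⟧ ρ

  -- Matches on its second argument like _─_ does, so that ⟦⟧-∷ holds by computation.
  _∖_ : Bool → Bool → Bool
  x ∖ true  = false
  x ∖ false = x

  ⟦_⟧ᵇ : ∀ {k} → Expr k → Vec Bool k → Bool
  ⟦ var i    ⟧ᵇ β = lookup β i
  ⟦ ∅ₑ       ⟧ᵇ β = false
  ⟦ e ∩ₑ e′ ⟧ᵇ β = ⟦ e ⟧ᵇ β ∧ ⟦ e′ ⟧ᵇ β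
  ⟦ e ∪ₑ e′ ⟧ᵇ β = ⟦ e ⟧ᵇ β ∨ ⟦ e′ ⟧ᵇ β
  ⟦ e ─ₑ e′ ⟧ᵇ β = ⟦ e ⟧ᵇ β ∖ ⟦ e′ ⟧ᵇ β

  head∷tail : ∀ {A : Set} {n} (v : Vec A (suc n)) → v ≡ head v ∷ tail v
  head∷tail (x ∷ v) = refl

  ⟦⟧-∷ : ∀ {k n} (e : Expr k) (ρ : Vec (Subset (suc n)) k) →
         ⟦ e ⟧ ρ ≡ ⟦ e ⟧ᵇ (map head ρ) ∷ ⟦ e ⟧ (map tail ρ)
  ⟦⟧-∷ (var i) ρ rewrite lookup-map i head ρ | lookup-map i tail ρ = head∷tail (lookup ρ i)
  ⟦⟧-∷ ∅ₑ ρ = refl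
  ⟦⟧-∷ (e ∩ₑ e′) ρ rewrite ⟦⟧-∷ e ρ | ⟦⟧-∷ e′ ρ = refl
  ⟦⟧-∷ (e ∪ₑ e′) ρ rewrite ⟦⟧-∷ e ρ | ⟦⟧-∷ e′ ρ = refl
  ⟦⟧-∷ (e ─ₑ e′) ρ rewrite ⟦⟧-∷ e ρ | ⟦⟧-∷ e′ ρ with ⟦ e′ ⟧ᵇ (map head ρ)
  ... | true  = refl
  ... | false = refl

  ⟦⟧-pointwise : ∀ {k} (e e′ : Expr k) → (∀ β → ⟦ e ⟧ᵇ β ≡ ⟦ e′ ⟧ᵇ β) →
                 ∀ {n} (ρ : Vec (Subset n) k) → ⟦ e ⟧ ρ ≡ ⟦ e′ ⟧ ρ
  ⟦⟧-pointwise e e′ eq {zero} ρ with ⟦ e ⟧ ρ | ⟦ e′ ⟧ ρ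
  ... | [] | [] = refl
  ⟦⟧-pointwise e e′ eq {suc n} ρ = begin
    ⟦ e ⟧ ρ                                     ≡⟨ ⟦⟧-∷ e ρ ⟩
    ⟦ e ⟧ᵇ (map head ρ) ∷ ⟦ e ⟧ (map tail ρ)
      ≡⟨ cong₂ _∷_ (eq (map head ρ)) (⟦⟧-pointwise e e′ eq (map tail ρ)) ⟩
    ⟦ e′ ⟧ᵇ (map head ρ) ∷ ⟦ e′ ⟧ (map tail ρ)  ≡⟨ sym (⟦⟧-∷ e′ ρ) ⟩
    ⟦ e′ ⟧ ρ                                    ∎
    where open ≡-Reasoning

  ∀-Vec-Bool? : ∀ {k} {P : Vec Bool k → Set} → (∀ β → Dec (P β)) → Dec (∀ β → P β)
  ∀-Vec-Bool? {zero} P? = map′ (λ { p [] → p }) (λ ∀P → ∀P []) (P? [])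
  ∀-Vec-Bool? {suc k} P? =
    map′ (λ { (∀Pt , ∀Pf) (true ∷ β) → ∀Pt β ; (∀Pt , ∀Pf) (false ∷ β) → ∀Pf β })
         (λ ∀P → (λ β → ∀P (true ∷ β)) , (λ β → ∀P (false ∷ β)))
         (∀-Vec-Bool? (λ β → P? (true ∷ β)) ×-dec ∀-Vec-Bool? (λ β → P? (false ∷ β)))

  Valid : ∀ {k} → Expr k → Expr k → Set
  Valid e e′ = True (∀-Vec-Bool? (λ β → ⟦ e ⟧ᵇ β Bool.≟ ⟦ e′ ⟧ᵇ β))

  solve : ∀ {k} (e e′ : Expr k) → {Valid e e′} → ∀ {n} (ρ : Vec (Subset n) k) → ⟦ e ⟧ ρ ≡ ⟦ e′ ⟧ ρ
  solve e e′ {valid} = ⟦⟧-pointwise e e′ (toWitness valid)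

  solve-⊆ : ∀ {k} (e e′ : Expr k) → {Valid e (e ∩ₑ e′)} → ∀ {n} (ρ : Vec (Subset n) k) → ⟦ e ⟧ ρ ⊆ ⟦ e′ ⟧ ρ
  solve-⊆ e e′ {valid} ρ {x} x∈e = p∩q⊆q (⟦ e ⟧ ρ) _ (subst (x ∈_) (solve e (e ∩ₑ e′) {valid} ρ) x∈e)

open SubsetExpr using (Expr; var; ∅ₑ; _∩ₑ_; _∪ₑ_; _─ₑ_; solve; solve-⊆)

private
  z w a b : Expr 4
  z = var (# 0)
  w = var (# 1)
  a = var (# 2)
  b = var (# 3)

  ⟨_,_,_,_⟩ : ∀ {n} → Subset n → Subset n → Subset n → Subset n → Vec (Subset n) 4
  ⟨ Z , W , A , B ⟩ = Z ∷ W ∷ A ∷ B ∷ []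

module _ {n : ℕ} where

  ∩-monoˡ-⊆ : ∀ {X Y : Subset n} (Z : Subset n) → X ⊆ Y → X ∩ Z ⊆ Y ∩ Z
  ∩-monoˡ-⊆ {X} Z X⊆Y x∈X∩Z = x∈p∩q⁺ (X⊆Y (proj₁ (x∈p∩q⁻ X Z x∈X∩Z)) , proj₂ (x∈p∩q⁻ X Z x∈X∩Z))

  p⊆q⇒p≡p∩q : ∀ {X Y : Subset n} → X ⊆ Y → X ≡ X ∩ Y
  p⊆q⇒p≡p∩q {X} X⊆Y = ⊆-antisym (λ x∈X → x∈p∩q⁺ (x∈X , X⊆Y x∈X)) (p∩q⊆p X _)

  ∩-distribʳ-∩ : ∀ (E X Y : Subset n) → (X ∩ Y) ∩ E ≡ (X ∩ E) ∩ (Y ∩ E)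
  ∩-distribʳ-∩ E X Y = solve ((z ∩ₑ w) ∩ₑ a) ((z ∩ₑ a) ∩ₑ (w ∩ₑ a)) ⟨ X , Y , E , E ⟩

∣p∩q∣+∣p─q∣≡∣p∣ : ∀ {n} (X Y : Subset n) → ∣ X ∩ Y ∣ + ∣ X ─ Y ∣ ≡ ∣ X ∣
∣p∩q∣+∣p─q∣≡∣p∣ [] [] = refl
∣p∩q∣+∣p─q∣≡∣p∣ (true ∷ X) (true ∷ Y) = cong suc (∣p∩q∣+∣p─q∣≡∣p∣ X Y)
∣p∩q∣+∣p─q∣≡∣p∣ (true ∷ X) (false ∷ Y) = trans (+-suc ∣ X ∩ Y ∣ _) (cong suc (∣p∩q∣+∣p─q∣≡∣p∣ X Y))
∣p∩q∣+∣p─q∣≡∣p∣ (false ∷ X) (true ∷ Y) = ∣p∩q∣+∣p─q∣≡∣p∣ X Y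
∣p∩q∣+∣p─q∣≡∣p∣ (false ∷ X) (false ∷ Y) = ∣p∩q∣+∣p─q∣≡∣p∣ X Y

∣p∪q∣+∣p∩q∣≡∣p∣+∣q∣ : ∀ {n} (X Y : Subset n) → ∣ X ∪ Y ∣ + ∣ X ∩ Y ∣ ≡ ∣ X ∣ + ∣ Y ∣
∣p∪q∣+∣p∩q∣≡∣p∣+∣q∣ [] [] = refl
∣p∪q∣+∣p∩q∣≡∣p∣+∣q∣ (true ∷ X) (true ∷ Y) =
  cong suc (trans (+-suc ∣ X ∪ Y ∣ _) (trans (cong suc (∣p∪q∣+∣p∩q∣≡∣p∣+∣q∣ X Y)) (sym (+-suc ∣ X ∣ _))))
∣p∪q∣+∣p∩q∣≡∣p∣+∣q∣ (true ∷ X) (false ∷ Y) = cong suc (∣p∪q∣+∣p∩q∣≡∣p∣+∣q∣ X Y)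
∣p∪q∣+∣p∩q∣≡∣p∣+∣q∣ (false ∷ X) (true ∷ Y) = trans (cong suc (∣p∪q∣+∣p∩q∣≡∣p∣+∣q∣ X Y)) (sym (+-suc ∣ X ∣ _))
∣p∪q∣+∣p∩q∣≡∣p∣+∣q∣ (false ∷ X) (false ∷ Y) = ∣p∪q∣+∣p∩q∣≡∣p∣+∣q∣ X Y

Submodular : ∀ {n} → (Subset n → ℕ) → Set
Submodular h = ∀ X Y → h (X ∪ Y) + h (X ∩ Y) ≤ h X + h Y

module _ {n : ℕ} where

  Submodular-cong : ∀ {f g : Subset n → ℕ} → (∀ X → f X ≡ g X) → Submodular f → Submodular g
  Submodular-cong {f} {g} f≡g f-sub X Y =
    subst₂ _≤_ (cong₂ _+_ (f≡g (X ∪ Y)) (f≡g (X ∩ Y))) (cong₂ _+_ (f≡g X) (f≡g Y)) (f-sub X Y)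

  const-submodular : ∀ c → Submodular {n} (λ _ → c)
  const-submodular c X Y = ≤-refl

  +-submodular : ∀ {f g : Subset n → ℕ} → Submodular f → Submodular g → Submodular (λ X → f X + g X)
  +-submodular {f} {g} f-sub g-sub X Y = begin
    (f (X ∪ Y) + g (X ∪ Y)) + (f (X ∩ Y) + g (X ∩ Y)) ≡⟨ interchange (f (X ∪ Y)) _ _ _ ⟩
    (f (X ∪ Y) + f (X ∩ Y)) + (g (X ∪ Y) + g (X ∩ Y)) ≤⟨ +-mono-≤ (f-sub X Y) (g-sub X Y) ⟩
    (f X + f Y) + (g X + g Y)                         ≡⟨ interchange (f X) _ _ _ ⟩
    (f X + g X) + (f Y + g Y)                         ∎
    where open ≤-Reasoning

  ⊓-submodular : ∀ {f g : Subset n → ℕ} → Submodular f → Submodular g →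
                 (∀ X Y → f (X ∩ Y) + g (X ∪ Y) ≤ f X + g Y) → Submodular (λ X → f X ⊓ g X)
  ⊓-submodular {f} {g} f-sub g-sub cross X Y = by-cases (⊓-sel (f X) (g X)) (⊓-sel (f Y) (g Y))
    where
    h = λ S → f S ⊓ g S
    h≤f : ∀ S → h S ≤ f S
    h≤f S = m⊓n≤m (f S) (g S)
    h≤g : ∀ S → h S ≤ g S
    h≤g S = m⊓n≤n (f S) (g S)
    bound : ∀ {hX′ hY′ s} → h X ≡ hX′ → h Y ≡ hY′ → h (X ∪ Y) + h (X ∩ Y) ≤ s → s ≤ hX′ + hY′ →
            h (X ∪ Y) + h (X ∩ Y) ≤ h X + h Y
    bound hX≡ hY≡ le₁ le₂ = subst₂ (λ p q → _ ≤ p + q) (sym hX≡) (sym hY≡) (≤-trans le₁ le₂)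
    by-cases : h X ≡ f X ⊎ h X ≡ g X → h Y ≡ f Y ⊎ h Y ≡ g Y → h (X ∪ Y) + h (X ∩ Y) ≤ h X + h Y
    by-cases (inj₁ hX≡fX) (inj₁ hY≡fY) = bound hX≡fX hY≡fY (+-mono-≤ (h≤f (X ∪ Y)) (h≤f (X ∩ Y))) (f-sub X Y)
    by-cases (inj₂ hX≡gX) (inj₂ hY≡gY) = bound hX≡gX hY≡gY (+-mono-≤ (h≤g (X ∪ Y)) (h≤g (X ∩ Y))) (g-sub X Y)
    by-cases (inj₁ hX≡fX) (inj₂ hY≡gY) = bound hX≡fX hY≡gY (+-mono-≤ (h≤g (X ∪ Y)) (h≤f (X ∩ Y)))
      (subst (_≤ f X + g Y) (+-comm (f (X ∩ Y)) _) (cross X Y))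
    by-cases (inj₂ hX≡gX) (inj₁ hY≡fY) = bound hX≡gX hY≡fY (+-mono-≤ (h≤g (X ∪ Y)) (h≤f (X ∩ Y)))
      (subst₂ _≤_ (trans (cong₂ (λ P Q → f P + g Q) (∩-comm Y X) (∪-comm Y X))
                         (+-comm (f (X ∩ Y)) (g (X ∪ Y))))
                  (+-comm (f Y) (g X)) (cross Y X))

  ∣─∣-submodular : ∀ (A : Subset n) → Submodular (λ X → ∣ X ─ A ∣)
  ∣─∣-submodular A X Y = ≤-reflexive (begin
    ∣ (X ∪ Y) ─ A ∣ + ∣ (X ∩ Y) ─ A ∣
      ≡⟨ cong₂ (λ P Q → ∣ P ∣ + ∣ Q ∣)
           (solve ((z ∪ₑ w) ─ₑ a) ((z ─ₑ a) ∪ₑ (w ─ₑ a)) ⟨ X , Y , A , A ⟩)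
           (solve ((z ∩ₑ w) ─ₑ a) ((z ─ₑ a) ∩ₑ (w ─ₑ a)) ⟨ X , Y , A , A ⟩) ⟩
    ∣ (X ─ A) ∪ (Y ─ A) ∣ + ∣ (X ─ A) ∩ (Y ─ A) ∣ ≡⟨ ∣p∪q∣+∣p∩q∣≡∣p∣+∣q∣ (X ─ A) (Y ─ A) ⟩
    ∣ X ─ A ∣ + ∣ Y ─ A ∣                         ∎)
    where open ≡-Reasoning

module _ {n : ℕ} {E : Subset n} (M : Matroid n E) where

  rank-mono : ∀ {X Y} → X ⊆ Y → rank M X ≤ rank M Y
  rank-mono {X} {Y} X⊆Y = subst₂ _≤_ (sym (local M X)) (sym (local M Y))
    (monotone M (X ∩ E) (Y ∩ E) (∩-monoˡ-⊆ E X⊆Y) (p∩q⊆q Y E))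

  rank-submodular : Submodular (rank M)
  rank-submodular X Y = subst₂ _≤_
    (sym (cong₂ _+_ (trans (local M (X ∪ Y)) (cong (rank M) (∩-distribʳ-∪ E X Y)))
                    (trans (local M (X ∩ Y)) (cong (rank M) (∩-distribʳ-∩ E X Y)))))
    (sym (cong₂ _+_ (local M X) (local M Y)))
    (submodular M (X ∩ E) (Y ∩ E) (p∩q⊆q X E) (p∩q⊆q Y E))

  rank≤∣∣ : ∀ X → rank M X ≤ ∣ X ∣
  rank≤∣∣ X = begin
    rank M X       ≡⟨ local M X ⟩
    rank M (X ∩ E) ≤⟨ bounded M (X ∩ E) (p∩q⊆q X E) ⟩
    ∣ X ∩ E ∣      ≤⟨ ∣p∩q∣≤∣p∣ X E ⟩
    ∣ X ∣          ∎
    where open ≤-Reasoning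

  rank≤rank+∣∣ : ∀ {X Y Z} → X ⊆ Y ∪ Z → rank M X ≤ rank M Y + ∣ Z ∣
  rank≤rank+∣∣ {X} {Y} {Z} X⊆Y∪Z = begin
    rank M X                              ≤⟨ rank-mono X⊆Y∪Z ⟩
    rank M (Y ∪ Z)                        ≤⟨ m≤m+n _ _ ⟩
    rank M (Y ∪ Z) + rank M (Y ∩ Z)       ≤⟨ rank-submodular Y Z ⟩
    rank M Y + rank M Z                   ≤⟨ +-monoʳ-≤ (rank M Y) (rank≤∣∣ Z) ⟩
    rank M Y + ∣ Z ∣                      ∎
    where open ≤-Reasoning

rank≤⇒≤w : ∀ {n} {E : Subset n} {L P : Matroid n E} → (∀ X → rank L X ≤ rank P X) → L ≤w P
rank≤⇒≤w {L = L} {P} rL≤rP I (I⊆E , rL≡∣I∣) =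
  I⊆E , ≤-antisym (rank≤∣∣ P I) (subst (_≤ rank P I) rL≡∣I∣ (rL≤rP I))

matroidOfRank : ∀ {n} (U : Subset n) (h : Subset n → ℕ) →
                (∀ X → h X ≤ ∣ X ∣) → (∀ {X Y} → X ⊆ Y → h X ≤ h Y) → Submodular h → Matroid n U
matroidOfRank U h h≤∣∣ h-mono h-submodular = record
  { rank       = λ X → h (X ∩ U)
  ; local      = λ X → cong h (sym (trans (∩-assoc X U U) (cong (X ∩_) (∩-idem U))))
  ; bounded    = λ X _ → ≤-trans (h≤∣∣ (X ∩ U)) (∣p∩q∣≤∣p∣ X U)
  ; monotone   = λ X Y X⊆Y _ → h-mono (∩-monoˡ-⊆ U X⊆Y)
  ; submodular = λ X Y _ _ → subst₂ (λ P Q → h P + h Q ≤ h (X ∩ U) + h (Y ∩ U))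
                   (sym (∩-distribʳ-∪ U X Y)) (sym (∩-distribʳ-∩ U X Y)) (h-submodular (X ∩ U) (Y ∩ U))
  }

module FreeSplice {n : ℕ} {A B : Subset n} (M : Matroid n A) (N : Matroid n B) (matched : Matched M N) where

  private
    u c d : Expr 4
    u = a ∪ₑ b
    c = a ∩ₑ b
    d = a ─ₑ b

    ⟪_,_⟫ : Subset n → Subset n → Vec (Subset n) 4
    ⟪ Z , W ⟫ = ⟨ Z , W , A , B ⟩

  U C D : Subset n
  U = A ∪ B
  C = A ∩ B
  D = A ─ B

  f g : Subset n → ℕ
  f Z = rank M (Z ∩ A) + ∣ Z ─ A ∣
  g Z = rank N (Z ∩ B) + rank M D

  matched-rank : ∀ Y → rank N (Y ∩ C) + rank M D ≡ rank M ((Y ∩ C) ∪ D)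
  matched-rank Y = begin
    rank N (Y ∩ C) + rank M D                      ≡⟨ cong (_+ rank M D) (sym contracted) ⟩
    (rank M ((Y ∩ C) ∪ D) ∸ rank M D) + rank M D   ≡⟨ m∸n+n≡m (rank-mono M (q⊆p∪q (Y ∩ C) D)) ⟩
    rank M ((Y ∩ C) ∪ D)                           ∎
    where
    open ≡-Reasoning
    contracted : rank M ((Y ∩ C) ∪ D) ∸ rank M D ≡ rank N (Y ∩ C)
    contracted = subst (λ S → rank M ((Y ∩ C) ∪ S) ∸ rank M S ≡ rank N (Y ∩ C))
                   (solve (a ─ₑ c) d ⟪ Y , Y ⟫) (matched Y)

  f-submodular : Submodular f
  f-submodular = +-submodular {f = λ Z → rank M (Z ∩ A)}
    (Submodular-cong (local M) (rank-submodular M)) (∣─∣-submodular A)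

  g-submodular : Submodular g
  g-submodular = +-submodular {f = λ Z → rank N (Z ∩ B)}
    (Submodular-cong (local N) (rank-submodular N)) (const-submodular (rank M D))

  -- Adding rank N (Z ∩ W ∩ C) + rank M D to both sides, the matching condition turns this into
  -- one submodular inequality for N plus one for M.
  exchange : ∀ Z W → rank M ((Z ∩ W) ∩ A) + rank N ((W ∩ B) ∪ (Z ∩ C)) ≤ rank M (Z ∩ A) + rank N (W ∩ B)
  exchange Z W = +-cancelʳ-≤ (nPC + mD) _ _ (begin
    (mPA + nQ) + (nPC + mD)   ≡⟨ shuffle₁ mPA nQ nPC mD ⟩
    mPA + ((nQ + nPC) + mD)   ≤⟨ +-monoʳ-≤ mPA (+-monoˡ-≤ mD N-step) ⟩
    mPA + ((nWB + nZC) + mD)  ≡⟨ shuffle₂ mPA nWB nZC mD ⟩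
    nWB + ((nZC + mD) + mPA)  ≤⟨ +-monoʳ-≤ nWB M-step ⟩
    nWB + ((nPC + mD) + mZA)  ≡⟨ shuffle₃ nWB nPC mD mZA ⟩
    (mZA + nWB) + (nPC + mD)  ∎)
    where
    open ≤-Reasoning
    P = Z ∩ W
    Q = (W ∩ B) ∪ (Z ∩ C)
    mPA = rank M (P ∩ A)
    mZA = rank M (Z ∩ A)
    mD  = rank M D
    nQ  = rank N Q
    nPC = rank N (P ∩ C)
    nZC = rank N (Z ∩ C)
    nWB = rank N (W ∩ B)
    N-step : nQ + nPC ≤ nWB + nZC
    N-step = ≤-trans
      (+-monoʳ-≤ nQ (rank-mono N (solve-⊆ ((z ∩ₑ w) ∩ₑ c) ((w ∩ₑ b) ∩ₑ (z ∩ₑ c)) ⟪ Z , W ⟫)))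
      (rank-submodular N (W ∩ B) (Z ∩ C))
    M-step : (nZC + mD) + mPA ≤ (nPC + mD) + mZA
    M-step = subst₂ (λ r r′ → r + mPA ≤ r′ + mZA)
      (sym (matched-rank Z)) (sym (matched-rank P))
      (≤-trans (+-mono-≤ (rank-mono M (solve-⊆ ((z ∩ₑ c) ∪ₑ d) (s ∪ₑ (z ∩ₑ a)) ⟪ Z , W ⟫))
                         (rank-mono M (solve-⊆ ((z ∩ₑ w) ∩ₑ a) (s ∩ₑ (z ∩ₑ a)) ⟪ Z , W ⟫)))
               (rank-submodular M ((P ∩ C) ∪ D) (Z ∩ A)))
      where s = ((z ∩ₑ w) ∩ₑ c) ∪ₑ d
    shuffle₁ : ∀ x y v d → (x + y) + (v + d) ≡ x + ((y + v) + d)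
    shuffle₁ = solve-∀
    shuffle₂ : ∀ x y v d → x + ((y + v) + d) ≡ y + ((v + d) + x)
    shuffle₂ = solve-∀
    shuffle₃ : ∀ y v d x → y + ((v + d) + x) ≡ (x + y) + (v + d)
    shuffle₃ = solve-∀

  f-g-cross : ∀ Z W → f (Z ∩ W) + g (Z ∪ W) ≤ f Z + g W
  f-g-cross Z W = begin
    (mPA + ∣ P ─ A ∣) + (rank N ((Z ∪ W) ∩ B) + mD)
      ≤⟨ +-monoʳ-≤ (mPA + ∣ P ─ A ∣) (+-monoˡ-≤ mD (rank≤rank+∣∣ N
           (solve-⊆ ((z ∪ₑ w) ∩ₑ b) (((w ∩ₑ b) ∪ₑ (z ∩ₑ c)) ∪ₑ ((z ─ₑ a) ─ₑ w)) ⟪ Z , W ⟫))) ⟩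
    (mPA + ∣ P ─ A ∣) + ((nQ + ∣ R ∣) + mD)      ≡⟨ shuffle mPA (∣ P ─ A ∣) nQ (∣ R ∣) mD ⟩
    (mPA + nQ) + ((∣ P ─ A ∣ + ∣ R ∣) + mD)      ≤⟨ +-mono-≤ (exchange Z W) (≤-reflexive (cong (_+ mD) split)) ⟩
    (mZA + nWB) + (∣ Z ─ A ∣ + mD)              ≡⟨ interchange mZA nWB (∣ Z ─ A ∣) mD ⟩
    (mZA + ∣ Z ─ A ∣) + (nWB + mD)              ∎
    where
    open ≤-Reasoning
    P = Z ∩ W
    Q = (W ∩ B) ∪ (Z ∩ C)
    R = (Z ─ A) ─ W
    mPA = rank M (P ∩ A)
    mZA = rank M (Z ∩ A)
    mD  = rank M D
    nQ  = rank N Q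
    nWB = rank N (W ∩ B)
    split : ∣ P ─ A ∣ + ∣ R ∣ ≡ ∣ Z ─ A ∣
    split = trans (cong (λ S → ∣ S ∣ + ∣ R ∣) (solve ((z ∩ₑ w) ─ₑ a) ((z ─ₑ a) ∩ₑ w) ⟪ Z , W ⟫))
                  (∣p∩q∣+∣p─q∣≡∣p∣ (Z ─ A) W)
    shuffle : ∀ x p y r d → (x + p) + ((y + r) + d) ≡ (x + y) + ((p + r) + d)
    shuffle = solve-∀

  f-mono : ∀ {X Y} → X ⊆ Y → f X ≤ f Y
  f-mono {X} {Y} X⊆Y = subst (_≤ f Y) (cong f (sym (p⊆q⇒p≡p∩q X⊆Y)))
    (+-mono-≤ (rank-mono M (solve-⊆ ((z ∩ₑ w) ∩ₑ a) (w ∩ₑ a) ⟪ X , Y ⟫))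
              (p⊆q⇒∣p∣≤∣q∣ (solve-⊆ ((z ∩ₑ w) ─ₑ a) (w ─ₑ a) ⟪ X , Y ⟫)))

  g-mono : ∀ {X Y} → X ⊆ Y → g X ≤ g Y
  g-mono X⊆Y = +-monoˡ-≤ (rank M D) (rank-mono N (∩-monoˡ-⊆ B X⊆Y))

  f≤∣∣ : ∀ X → f X ≤ ∣ X ∣
  f≤∣∣ X = ≤-trans (+-monoˡ-≤ ∣ X ─ A ∣ (rank≤∣∣ M (X ∩ A))) (≤-reflexive (∣p∩q∣+∣p─q∣≡∣p∣ X A))

  freeSplice : Matroid n U
  freeSplice = matroidOfRank U (λ Z → f Z ⊓ g Z)
    (λ X → ≤-trans (m⊓n≤m (f X) (g X)) (f≤∣∣ X))
    (λ X⊆Y → ⊓-mono-≤ (f-mono X⊆Y) (g-mono X⊆Y))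
    (⊓-submodular {f = f} {g = g} f-submodular g-submodular f-g-cross)

  rank-U─B : (L : Matroid n U) → (∀ Y → restrictRank L A Y ≡ rank M Y) → rank L (U ─ B) ≡ rank M D
  rank-U─B L L|A≡M = trans (cong (rank L) (solve (u ─ₑ b) (d ∩ₑ a) ⟪ A , A ⟫)) (L|A≡M D)

  rank-M≤g : ∀ Z → rank M (Z ∩ A) ≤ g Z
  rank-M≤g Z = begin
    rank M (Z ∩ A)              ≤⟨ rank-mono M (solve-⊆ (z ∩ₑ a) ((z ∩ₑ c) ∪ₑ d) ⟪ Z , Z ⟫) ⟩
    rank M ((Z ∩ C) ∪ D)        ≡⟨ sym (matched-rank Z) ⟩
    rank N (Z ∩ C) + rank M D   ≤⟨ +-monoˡ-≤ (rank M D) (rank-mono N (solve-⊆ (z ∩ₑ c) (z ∩ₑ b) ⟪ Z , Z ⟫)) ⟩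
    g Z                         ∎
    where open ≤-Reasoning

  g≤f-above-D : ∀ Z → g (Z ∪ D) ≤ f (Z ∪ D)
  g≤f-above-D Z = begin
    rank N (V ∩ B) + rank M D                ≤⟨ +-monoˡ-≤ (rank M D) (rank≤rank+∣∣ N
                                                  (solve-⊆ (v ∩ₑ b) ((v ∩ₑ c) ∪ₑ (v ─ₑ a)) ⟪ Z , Z ⟫)) ⟩
    (rank N (V ∩ C) + ∣ V ─ A ∣) + rank M D  ≡⟨ +-comm-middle (rank N (V ∩ C)) (∣ V ─ A ∣) (rank M D) ⟩
    (rank N (V ∩ C) + rank M D) + ∣ V ─ A ∣  ≡⟨ cong (_+ ∣ V ─ A ∣) (matched-rank V) ⟩
    rank M ((V ∩ C) ∪ D) + ∣ V ─ A ∣         ≤⟨ +-monoˡ-≤ (∣ V ─ A ∣)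
                                                  (rank-mono M (solve-⊆ ((v ∩ₑ c) ∪ₑ d) (v ∩ₑ a) ⟪ Z , Z ⟫)) ⟩
    rank M (V ∩ A) + ∣ V ─ A ∣               ∎
    where
    open ≤-Reasoning
    V = Z ∪ D
    v = z ∪ₑ d
    +-comm-middle : ∀ x y r → (x + y) + r ≡ (x + r) + y
    +-comm-middle = solve-∀

  freeSplice-restrict : ∀ Y → restrictRank freeSplice A Y ≡ rank M Y
  freeSplice-restrict Y = begin
    f Z ⊓ g Z        ≡⟨ m≤n⇒m⊓n≡m (subst (_≤ g Z) (sym fZ≡rank-M) (rank-M≤g Z)) ⟩
    f Z              ≡⟨ fZ≡rank-M ⟩
    rank M (Z ∩ A)   ≡⟨ cong (rank M) (solve (((z ∩ₑ a) ∩ₑ u) ∩ₑ a) (z ∩ₑ a) ⟪ Y , Y ⟫) ⟩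
    rank M (Y ∩ A)   ≡⟨ sym (local M Y) ⟩
    rank M Y         ∎
    where
    open ≡-Reasoning
    Z = (Y ∩ A) ∩ U
    fZ≡rank-M : f Z ≡ rank M (Z ∩ A)
    fZ≡rank-M = begin
      rank M (Z ∩ A) + ∣ Z ─ A ∣
        ≡⟨ cong (λ S → rank M (Z ∩ A) + ∣ S ∣) (solve (((z ∩ₑ a) ∩ₑ u) ─ₑ a) ∅ₑ ⟪ Y , Y ⟫) ⟩
      rank M (Z ∩ A) + ∣ ⊥ {n} ∣  ≡⟨ cong (rank M (Z ∩ A) +_) (∣⊥∣≡0 n) ⟩
      rank M (Z ∩ A) + 0          ≡⟨ +-identityʳ _ ⟩
      rank M (Z ∩ A)              ∎

  freeSplice-contract : ∀ Y → contractRank freeSplice B Y ≡ rank N Y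
  freeSplice-contract Y = begin
    rank freeSplice ((Y ∩ B) ∪ (U ─ B)) ∸ rank freeSplice (U ─ B)
      ≡⟨ cong₂ _∸_ spanned (rank-U─B freeSplice freeSplice-restrict) ⟩
    (rank N Y + rank M D) ∸ rank M D
      ≡⟨ m+n∸n≡m (rank N Y) (rank M D) ⟩
    rank N Y ∎
    where
    open ≡-Reasoning
    V = (Y ∩ B) ∪ D
    spanned : rank freeSplice ((Y ∩ B) ∪ (U ─ B)) ≡ rank N Y + rank M D
    spanned = begin
      rank freeSplice ((Y ∩ B) ∪ (U ─ B))
        ≡⟨ cong (λ S → f S ⊓ g S) (solve (((z ∩ₑ b) ∪ₑ (u ─ₑ b)) ∩ₑ u) ((z ∩ₑ b) ∪ₑ d) ⟪ Y , Y ⟫) ⟩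
      f V ⊓ g V
        ≡⟨ m≥n⇒m⊓n≡n (g≤f-above-D (Y ∩ B)) ⟩
      rank N (V ∩ B) + rank M D
        ≡⟨ cong (λ S → rank N S + rank M D) (solve (((z ∩ₑ b) ∪ₑ d) ∩ₑ b) (z ∩ₑ b) ⟪ Y , Y ⟫) ⟩
      rank N (Y ∩ B) + rank M D
        ≡⟨ cong (_+ rank M D) (sym (local N Y)) ⟩
      rank N Y + rank M D
        ∎

  splice-rank≤freeSplice : ∀ (L : Matroid n U) → IsSplice M N L → ∀ X → rank L X ≤ rank freeSplice X
  splice-rank≤freeSplice L (L|A≡M , L/B≡N) X = ⊓-glb rank-L≤f rank-L≤g
    where
    open ≤-Reasoning
    V = X ∩ U
    v = z ∩ₑ u
    S = (V ∩ B) ∪ (U ─ B)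
    rank-L≤f : rank L X ≤ f V
    rank-L≤f = begin
      rank L X                          ≡⟨ local L X ⟩
      rank L V                          ≤⟨ rank≤rank+∣∣ L (solve-⊆ z ((z ∩ₑ a) ∪ₑ (z ─ₑ a)) ⟪ V , V ⟫) ⟩
      rank L (V ∩ A) + ∣ V ─ A ∣        ≡⟨ cong (_+ ∣ V ─ A ∣) (trans (L|A≡M V) (local M V)) ⟩
      rank M (V ∩ A) + ∣ V ─ A ∣        ∎
    rank-L≤g : rank L X ≤ g V
    rank-L≤g = begin
      rank L X                                    ≡⟨ local L X ⟩
      rank L V                                    ≤⟨ rank-mono L (solve-⊆ v ((v ∩ₑ b) ∪ₑ (u ─ₑ b)) ⟪ X , X ⟫) ⟩
      rank L S                                    ≡⟨ sym (m∸n+n≡m (rank-mono L (q⊆p∪q (V ∩ B) (U ─ B)))) ⟩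
      (rank L S ∸ rank L (U ─ B)) + rank L (U ─ B) ≡⟨ cong₂ _+_ (L/B≡N V) (rank-U─B L L|A≡M) ⟩
      rank N V + rank M D                         ≡⟨ cong (_+ rank M D) (local N V) ⟩
      rank N (V ∩ B) + rank M D                   ∎

theorem3p6 : (n : ℕ) (A B : Subset n) (M : Matroid n A) (N : Matroid n B) →
    Matched M N →
    Σ (Matroid n (A ∪ B)) (λ F →
      (∀ X → rank F X ≡ freeSpliceRank M N X) ×
      IsSplice M N F ×
      (∀ (L : Matroid n (A ∪ B)) → IsSplice M N L → L ≤w F))
theorem3p6 n A B M N matched =
  freeSplice ,
  (λ X → refl) ,
  (freeSplice-restrict , freeSplice-contract) ,
  (λ L L-splice → rank≤⇒≤w {L = L} {P = freeSplice} (splice-rank≤freeSplice L L-splice))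
  where open FreeSplice M N matched
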